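{- Let $p$ be a prime with $p\equiv5\pmod8$ and let $m,n$ be odd integers. With $\alpha=\alpha(m,n)$, $N=N_{k/\mathbb Q}(\alpha)$ and $T=\mathrm{Tr}_{k/\mathbb Q}(\alpha)$ as in the context, $$(N+4)^2-4T^2=\mathcal L_m^2\,b^2p\,(\mathcal L_m\mathcal F_n-2\mathcal F_m)^2.$$ In particular, $(N+4)^2-4T^2\in p\,\mathbb Q^2$.
   Context: Let $k=\mathbb Q(\sqrt p)$ and $u_p=(t+b\sqrt p)/2>1$ ($t,b$ positive integers) its fundamental unit. Sequences indexed by $n\in\mathbb Z$: $\mathcal F_0=0,\ \mathcal F_1=1,\ \mathcal F_{n+2}=t\mathcal F_{n+1}+\mathcal F_n$ and $\mathcal L_0=2,\ \mathcal L_1=t,\ \mathcal L_{n+2}=t\mathcal L_{n+1}+\mathcal L_n$. For integers $m,n$, $\alpha(m,n):=\frac{\mathcal L_n\mathcal L_m+(\mathcal L_m\mathcal F_n-2\mathcal F_m)b\sqrt p}{2}\in k$. -}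

module Defs where

open import Data.Nat as ℕ using (ℕ; zero; suc)
open import Data.Integer as ℤ using (ℤ; +_; -[1+_])
open import Data.Rational as ℚ using (ℚ)
open import Data.Product using (_×_; _,_; proj₁; ∃)
open import Data.Sum using (_⊎_)
open import Relation.Binary.PropositionalEquality using (_≡_)

-- Integer-indexed sequence s with s 0 = x0, s 1 = x1, s (n+2) = t * s (n+1) + s n
-- (extended to negative indices by s n = s (n+2) - t * s (n+1)).
private
  fwd : ℤ → ℤ → ℤ → ℕ → ℤ × ℤ          -- (s k , s (k+1))
  fwd t x0 x1 zero = x0 , x1
  fwd t x0 x1 (suc k) with fwd t x0 x1 k
  ... | (a , c) = c , (t ℤ.* c ℤ.+ a)

  bwd : ℤ → ℤ → ℤ → ℕ → ℤ × ℤ          -- (s (-(k+1)) , s (-k))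
  bwd t x0 x1 zero = (x1 ℤ.- t ℤ.* x0) , x0
  bwd t x0 x1 (suc k) with bwd t x0 x1 k
  ... | (a , c) = (c ℤ.- t ℤ.* a) , a

linRec : ℤ → ℤ → ℤ → ℤ → ℤ
linRec t x0 x1 (+ k)     = proj₁ (fwd t x0 x1 k)
linRec t x0 x1 -[1+ k ]  = proj₁ (bwd t x0 x1 k)

𝓕 : ℕ → ℤ → ℤ
𝓕 t = linRec (+ t) (+ 0) (+ 1)

𝓛 : ℕ → ℤ → ℤ
𝓛 t = linRec (+ t) (+ 2) (+ t)

toℚ : ℤ → ℚ
toℚ z = z ℚ./ 1

-- Elements of k = ℚ(√p), written a + c √p with a c ∈ ℚ
record Qsqrt : Set where
  constructor mkQ
  field
    re : ℚ
    im : ℚ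
open Qsqrt public

norm : ℕ → Qsqrt → ℚ
norm p x = re x ℚ.* re x ℚ.- (toℚ (+ p)) ℚ.* (im x ℚ.* im x)

trace : ℕ → Qsqrt → ℚ
trace p x = re x ℚ.+ re x

-- ε = (x + y√p)/2 with x² - p y² = ±4 ; for p ≡ 1 (mod 4) these are exactly
-- the units of the ring of integers of ℚ(√p)
IsUnitCoords : ℕ → ℤ → ℤ → Set
IsUnitCoords p x y =
  (x ℤ.* x ℤ.- + p ℤ.* (y ℤ.* y) ≡ + 4) ⊎ (x ℤ.* x ℤ.- + p ℤ.* (y ℤ.* y) ≡ ℤ.- + 4)

-- u = (t + b√p)/2 > 1 (t,b positive) is the fundamental unit:
-- it is a unit, and it is the smallest unit > 1, i.e. every unit
-- (t' + b'√p)/2 > 1 (equivalently t',b' > 0) has t ≤ t' and b ≤ b'.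
IsFundamentalUnit : ℕ → ℕ → ℕ → Set
IsFundamentalUnit p t b =
  (1 ℕ.≤ t) × (1 ℕ.≤ b) × IsUnitCoords p (+ t) (+ b) ×
  (∀ (t' b' : ℕ) → 1 ℕ.≤ t' → 1 ℕ.≤ b' → IsUnitCoords p (+ t') (+ b') →
     (t ℕ.≤ t') × (b ℕ.≤ b'))

α : ℕ → ℕ → ℤ → ℤ → Qsqrt
α t b m n =
  mkQ (toℚ (𝓛 t n ℤ.* 𝓛 t m) ℚ.* ℚ.½)
      (toℚ ((𝓛 t m ℤ.* 𝓕 t n ℤ.- + 2 ℤ.* 𝓕 t m) ℤ.* + b) ℚ.* ℚ.½)

OddInt : ℤ → Set
OddInt m = ∃ λ j → m ≡ + 2 ℤ.* j ℤ.+ + 1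

module Submission where

-- For odd n the Lucas-type sequences satisfy 𝓛ₙ² + 4 = (t² + 4) 𝓕ₙ², a Cassini identity.
-- Since p ≡ 1 (mod 4), the fundamental unit has norm −1, i.e. t² + 4 = b² p: a unit of norm +1
-- would, through the splitting of t² − 4 = p b² into coprime factors, produce a unit of smaller
-- trace.  So with Δ = b² p, ℓ = 𝓛ₘ, M = 𝓛ₙ, f = 𝓕ₘ, g = 𝓕ₙ we have ℓ² + 4 = Δ f² and
-- M² + 4 = Δ g², from which N + 4 = ℓ (Δ f g − 2ℓ) and (Δ f g − 2ℓ)² − 4M² = Δ (ℓ g − 2f)²;
-- hence (N + 4)² − 4T² = (N + 4)² − 4M²ℓ² = ℓ² Δ (ℓ g − 2f)².

open import Defs
open import Data.Nat using (ℕ; _%_)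
open import Data.Nat.Primality using (Prime)
open import Data.Integer using (ℤ; +_)
open import Data.Product using (_×_; ∃)
open import Relation.Binary.PropositionalEquality using (_≡_)
import Data.Integer as ℤ
open import Data.Nat.DivMod using (m∣n⇒o%n%m≡o%m)
open import Data.Nat.Divisibility using (divides)
open import Relation.Binary.PropositionalEquality using (refl; sym; trans; cong; cong₂)

module LucasSequences where

  open import Data.Nat using (zero; suc)
  import Data.Nat.Properties as ℕ
  open import Data.Integer using (-[1+_]; _+_; _*_; _-_; -_; 0ℤ; 1ℤ)
  import Data.Integer.Properties as ℤ
  open import Data.Integer.Tactic.RingSolver using (solve-∀)
  open import Data.Product using (_,_; proj₁)
  open import Relation.Binary.PropositionalEquality using (subst; subst₂; module ≡-Reasoning)

  record Recurrence (T : ℤ) (s : ℤ → ℤ) : Set where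
    constructor recurrence
    field
      step : ∀ n → s (n + + 2) ≡ T * s (n + 1ℤ) + s n
  open Recurrence

  a≡Tc+[a-Tc] : ∀ T a c → a ≡ T * c + (a - T * c)
  a≡Tc+[a-Tc] = solve-∀

  linRec-step : ∀ T x₀ x₁ n →
                linRec T x₀ x₁ (n + + 2) ≡ T * linRec T x₀ x₁ (n + 1ℤ) + linRec T x₀ x₁ n
  linRec-step T x₀ x₁ (+ k) rewrite ℕ.+-comm k 2 | ℕ.+-comm k 1 = refl
  linRec-step T x₀ x₁ -[1+ 0 ]           = a≡Tc+[a-Tc] T x₁ x₀
  linRec-step T x₀ x₁ -[1+ 1 ]           = a≡Tc+[a-Tc] T x₀ (x₁ - T * x₀)
  linRec-step T x₀ x₁ -[1+ suc (suc k) ] = a≡Tc+[a-Tc] T _ _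

  linRec-recurrence : ∀ T x₀ x₁ → Recurrence T (linRec T x₀ x₁)
  linRec-recurrence T x₀ x₁ = recurrence (linRec-step T x₀ x₁)

  ℤ-induction : (P : ℤ → Set) → P 0ℤ →
                (∀ n → P n → P (n + 1ℤ)) → (∀ n → P (n + 1ℤ) → P n) → ∀ n → P n
  ℤ-induction P P₀ up down (+ zero)     = P₀
  ℤ-induction P P₀ up down (+ suc k)    =
    subst P (cong +_ (ℕ.+-comm k 1)) (up (+ k) (ℤ-induction P P₀ up down (+ k)))
  ℤ-induction P P₀ up down -[1+ zero ]  = down -[1+ 0 ] P₀
  ℤ-induction P P₀ up down -[1+ suc k ] =
    down -[1+ suc k ] (ℤ-induction P P₀ up down -[1+ k ])

  n+1+1≡n+2 : ∀ n → n + 1ℤ + 1ℤ ≡ n + + 2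
  n+1+1≡n+2 n = ℤ.+-assoc n 1ℤ 1ℤ

  a≡c+b⇒b≡a-c : ∀ a b c → a ≡ c + b → b ≡ a - c
  a≡c+b⇒b≡a-c _ b c refl = b≡c+b-c b c
    where
    b≡c+b-c : ∀ b c → b ≡ c + b - c
    b≡c+b-c = solve-∀

  recurrence-back : ∀ {T s} → Recurrence T s → ∀ n → s n ≡ s (n + + 2) - T * s (n + 1ℤ)
  recurrence-back rec n = a≡c+b⇒b≡a-c _ _ _ (step rec n)

  recurrence-unique : ∀ {T s s′} → Recurrence T s → Recurrence T s′ →
                      s 0ℤ ≡ s′ 0ℤ → s 1ℤ ≡ s′ 1ℤ → ∀ n → s n ≡ s′ n
  recurrence-unique {T} {s} {s′} rec rec′ e₀ e₁ n = proj₁ (ℤ-induction P (e₀ , e₁) up down n)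
    where
    P : ℤ → Set
    P n = s n ≡ s′ n × s (n + 1ℤ) ≡ s′ (n + 1ℤ)
    up : ∀ n → P n → P (n + 1ℤ)
    up n (eₙ , eₙ₊₁) rewrite n+1+1≡n+2 n | step rec n | step rec′ n | eₙ | eₙ₊₁ =
      refl , refl
    down : ∀ n → P (n + 1ℤ) → P n
    down n (eₙ₊₁ , eₙ₊₂) rewrite n+1+1≡n+2 n = (begin
      s n                            ≡⟨ recurrence-back rec n ⟩
      s (n + + 2) - T * s (n + 1ℤ)   ≡⟨ cong₂ (λ a c → a - T * c) eₙ₊₂ eₙ₊₁ ⟩
      s′ (n + + 2) - T * s′ (n + 1ℤ) ≡⟨ recurrence-back rec′ n ⟨
      s′ n                           ∎) , eₙ₊₁
      where open ≡-Reasoning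

  n+k+1≡n+1+k : ∀ n k → n + k + 1ℤ ≡ n + 1ℤ + k
  n+k+1≡n+1+k = solve-∀

  shift-recurrence : ∀ {T s} → Recurrence T s → Recurrence T (λ n → s (n + 1ℤ))
  shift-recurrence {T} {s} rec = recurrence λ n →
    subst₂ (λ i j → s i ≡ T * s j + s (n + 1ℤ))
           (sym (n+k+1≡n+1+k n (+ 2))) (sym (n+k+1≡n+1+k n 1ℤ)) (step rec (n + 1ℤ))

  combination-distrib : ∀ T a c x x′ y y′ →
    a * (T * x + x′) + c * (T * y + y′) ≡ T * (a * x + c * y) + (a * x′ + c * y′)
  combination-distrib = solve-∀

  combination-recurrence : ∀ {T u v} a c → Recurrence T u → Recurrence T v →
                           Recurrence T (λ n → a * u n + c * v n)
  combination-recurrence {T} {u} {v} a c recᵤ recᵥ = recurrence λ n →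
    trans (cong₂ (λ x y → a * x + c * y) (step recᵤ n) (step recᵥ n))
          (combination-distrib T a c (u (n + 1ℤ)) (u n) (v (n + 1ℤ)) (v n))

  𝓛≡2𝓕[n+1]-t𝓕 : ∀ t n → 𝓛 t n ≡ + 2 * 𝓕 t (n + 1ℤ) + - + t * 𝓕 t n
  𝓛≡2𝓕[n+1]-t𝓕 t = recurrence-unique (linRec-recurrence _ _ _)
    (combination-recurrence (+ 2) (- + t)
      (shift-recurrence (linRec-recurrence _ _ _)) (linRec-recurrence _ _ _))
    (at-0 (+ t)) (at-1 (+ t))
    where
    at-0 : ∀ T → + 2 ≡ + 2 * + 1 + - T * + 0
    at-0 = solve-∀
    at-1 : ∀ T → T ≡ + 2 * (T * + 1 + + 0) + - T * + 1
    at-1 = solve-∀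

  cassini : ℤ → (ℤ → ℤ) → ℤ → ℤ
  cassini T s n = s (n + 1ℤ) * s (n + 1ℤ) - T * s (n + 1ℤ) * s n - s n * s n

  cassini-flip : ∀ T c a →
    (T * c + a) * (T * c + a) - T * (T * c + a) * c - c * c ≡ - (c * c - T * c * a - a * a)
  cassini-flip = solve-∀

  cassini-step : ∀ {T s} → Recurrence T s → ∀ n → cassini T s (n + 1ℤ) ≡ - cassini T s n
  cassini-step {T} {s} rec n rewrite n+1+1≡n+2 n | step rec n = cassini-flip T (s (n + 1ℤ)) (s n)

  alternating-odd : ∀ (f : ℤ → ℤ) → (∀ n → f (n + 1ℤ) ≡ - f n) →
                    ∀ j → f (+ 2 * j + 1ℤ) ≡ - f 0ℤ
  alternating-odd f flip = ℤ-induction (λ j → f (+ 2 * j + 1ℤ) ≡ - f 0ℤ) (flip 0ℤ) up down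
    where
    two-steps : ∀ n → f (n + 1ℤ + 1ℤ) ≡ f n
    two-steps n = trans (flip (n + 1ℤ)) (trans (cong -_ (flip n)) (ℤ.neg-involutive (f n)))
    index : ∀ j → + 2 * (j + 1ℤ) + 1ℤ ≡ + 2 * j + 1ℤ + 1ℤ + 1ℤ
    index = solve-∀
    up : ∀ j → f (+ 2 * j + 1ℤ) ≡ - f 0ℤ → f (+ 2 * (j + 1ℤ) + 1ℤ) ≡ - f 0ℤ
    up j eq = trans (cong f (index j)) (trans (two-steps _) eq)
    down : ∀ j → f (+ 2 * (j + 1ℤ) + 1ℤ) ≡ - f 0ℤ → f (+ 2 * j + 1ℤ) ≡ - f 0ℤ
    down j eq = trans (sym (two-steps _)) (trans (cong f (sym (index j))) eq)

  square-via-cassini : ∀ T c a →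
    (+ 2 * c + - T * a) * (+ 2 * c + - T * a) + + 4 ≡
    (T * T + + 4) * (a * a) + + 4 * ((c * c - T * c * a - a * a) + + 1)
  square-via-cassini = solve-∀

  𝓛²+4≡[t²+4]𝓕² : ∀ t n → OddInt n →
                   𝓛 t n * 𝓛 t n + + 4 ≡ (+ t * + t + + 4) * (𝓕 t n * 𝓕 t n)
  𝓛²+4≡[t²+4]𝓕² t _ (j , refl) = begin
    𝓛 t n * 𝓛 t n + + 4
      ≡⟨ cong (λ l → l * l + + 4) (𝓛≡2𝓕[n+1]-t𝓕 t n) ⟩
    (+ 2 * 𝓕 t (n + 1ℤ) + - + t * 𝓕 t n) * (+ 2 * 𝓕 t (n + 1ℤ) + - + t * 𝓕 t n) + + 4
      ≡⟨ square-via-cassini (+ t) (𝓕 t (n + 1ℤ)) (𝓕 t n) ⟩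
    Δ𝓕² + + 4 * (cassini (+ t) (𝓕 t) n + + 1)
      ≡⟨ cong (λ z → Δ𝓕² + + 4 * (z + + 1)) cassini-odd ⟩
    Δ𝓕² + + 0
      ≡⟨ ℤ.+-identityʳ Δ𝓕² ⟩
    Δ𝓕² ∎
    where
    open ≡-Reasoning
    n Δ𝓕² : ℤ
    n = + 2 * j + 1ℤ
    Δ𝓕² = (+ t * + t + + 4) * (𝓕 t n * 𝓕 t n)
    cassini-at-0 : ∀ T → + 1 * + 1 - T * + 1 * + 0 - + 0 * + 0 ≡ + 1
    cassini-at-0 = solve-∀
    cassini-odd : cassini (+ t) (𝓕 t) n ≡ - + 1
    cassini-odd = trans (alternating-odd _ (cassini-step (linRec-recurrence _ _ _)) j)
                        (cong -_ (cassini-at-0 (+ t)))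

module NormOfFundamentalUnit where

  open import Data.Nat
  open import Data.Nat.Properties
  open import Data.Nat.DivMod using (_/_; [m+kn]%n≡m%n; m≡m%n+[m/n]*n)
  open import Data.Nat.Divisibility
  open import Data.Nat.Coprimality as Coprime using (Coprime; coprime-divisor)
  open import Data.Nat.GCD using (GCD; GCD-*; mkGCD)
  open import Data.Nat.Primality using (euclidsLemma; prime⇒nonZero)
  open import Data.Nat.Tactic.RingSolver using (solve)
  import Data.Integer.Properties as ℤ
  import Data.Integer.Tactic.RingSolver as ℤ-Solver
  open import Data.List.Base using (_∷_; [])
  open import Data.Product using (∃₂; _,_; proj₁)
  open import Data.Sum using (_⊎_; inj₁; inj₂)
  open import Relation.Nullary using (yes; no; contradiction)
  open import Relation.Binary.PropositionalEquality

  private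
    cofactor≡gcd : ∀ {x₁ y z₁ d} .{{_ : NonZero d}} → GCD (x₁ * d) (z₁ * d) (1 * d) →
                   Coprime (x₁ * d) y → x₁ * d * y ≡ z₁ * d * (z₁ * d) → x₁ ≡ d
    cofactor≡gcd {x₁} {y} {z₁} {d} gcd x⊥y xy≡z² = ∣-antisym x₁∣d d∣x₁
      where
      open ≡-Reasoning
      x₁⊥z₁ : Coprime x₁ z₁
      x₁⊥z₁ = Coprime.GCD≡1⇒coprime (GCD-* gcd)
      yx₁≡z₁²d : y * x₁ ≡ z₁ * (z₁ * d)
      yx₁≡z₁²d = *-cancelʳ-≡ _ _ d (begin
        y * x₁ * d          ≡⟨ solve (y ∷ x₁ ∷ d ∷ []) ⟩
        x₁ * d * y          ≡⟨ xy≡z² ⟩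
        z₁ * d * (z₁ * d)   ≡⟨ solve (z₁ ∷ d ∷ []) ⟩
        z₁ * (z₁ * d) * d   ∎)
      x₁∣d : x₁ ∣ d
      x₁∣d = coprime-divisor x₁⊥z₁ (coprime-divisor x₁⊥z₁ (divides y (sym yx₁≡z₁²d)))
      d⊥y : Coprime d y
      d⊥y (i∣d , i∣y) = x⊥y (∣-trans i∣d (n∣m*n x₁) , i∣y)
      d∣x₁ : d ∣ x₁
      d∣x₁ = coprime-divisor d⊥y (subst (d ∣_) (sym yx₁≡z₁²d) (∣-trans (n∣m*n z₁) (n∣m*n z₁)))

  -- With d = gcd x z, x = x₁ d and z = z₁ d we get y x₁ = z₁² d, so x₁ ∣ d as x₁ ⊥ z₁,
  -- and d ∣ x₁ as d ⊥ y.
  coprime-square-factor : ∀ {x y z} → Coprime x y → x * y ≡ z * z → ∃ λ d → x ≡ d * d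
  coprime-square-factor {x} {y} {z} x⊥y xy≡z² with mkGCD x z
  ... | zero , gcd₀ = 0 , 0∣⇒≡0 (proj₁ (GCD.commonDivisor gcd₀))
  ... | d@(suc _) , gcd with GCD.commonDivisor gcd
  ...   | divides x₁ refl , divides z₁ refl =
    d , cong (_* d) (cofactor≡gcd {x₁} {y} {z₁} (subst (GCD _ _) (sym (*-identityˡ d)) gcd)
                                  x⊥y xy≡z²)

  coprime-product≡square : ∀ {x y z} → Coprime x y → x * y ≡ z * z →
                           ∃₂ λ a c → x ≡ a * a × y ≡ c * c
  coprime-product≡square {x} {y} {z} x⊥y xy≡z²
    with coprime-square-factor {z = z} x⊥y xy≡z²
       | coprime-square-factor {z = z} (Coprime.sym x⊥y) (trans (*-comm y x) xy≡z²)
  ... | a , x≡a² | c , y≡c² = a , c , x≡a² , y≡c²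

  private
    prime-factor-square : ∀ {p X Y Z} → Prime p → Coprime X Y → X * Y ≡ p * (Z * Z) → p ∣ X →
                          ∃₂ λ a c → X ≡ p * (a * a) × Y ≡ c * c
    prime-factor-square {p} {_} {Y} {Z} p-prime X⊥Y XY≡pZ² (divides X′ refl) =
      attach-p (coprime-product≡square {z = Z} X′⊥Y X′Y≡Z²)
      where
      open ≡-Reasoning
      instance _ = prime⇒nonZero p-prime
      X′Y≡Z² : X′ * Y ≡ Z * Z
      X′Y≡Z² = *-cancelʳ-≡ _ _ p (begin
        X′ * Y * p   ≡⟨ solve (X′ ∷ Y ∷ p ∷ []) ⟩
        X′ * p * Y   ≡⟨ XY≡pZ² ⟩
        p * (Z * Z)  ≡⟨ *-comm p (Z * Z) ⟩
        Z * Z * p    ∎)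
      X′⊥Y : Coprime X′ Y
      X′⊥Y (i∣X′ , i∣Y) = X⊥Y (∣-trans i∣X′ (m∣m*n p) , i∣Y)
      attach-p : (∃₂ λ a c → X′ ≡ a * a × Y ≡ c * c) →
                 ∃₂ λ a c → X′ * p ≡ p * (a * a) × Y ≡ c * c
      attach-p (a , c , X′≡a² , Y≡c²) =
        a , c , trans (cong (_* p) X′≡a²) (*-comm (a * a) p) , Y≡c²

  coprime-product≡prime*square : ∀ {p X Y Z} → Prime p → Coprime X Y → X * Y ≡ p * (Z * Z) →
    (∃₂ λ a c → X ≡ p * (a * a) × Y ≡ c * c) ⊎ (∃₂ λ a c → X ≡ c * c × Y ≡ p * (a * a))
  coprime-product≡prime*square {p} {X} {Y} {Z} p-prime X⊥Y XY≡pZ²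
    with euclidsLemma X Y p-prime (divides (Z * Z) (trans XY≡pZ² (*-comm p (Z * Z))))
  ... | inj₁ p∣X = inj₁ (prime-factor-square {Z = Z} p-prime X⊥Y XY≡pZ² p∣X)
  ... | inj₂ p∣Y
    with prime-factor-square {Z = Z} p-prime (Coprime.sym X⊥Y) (trans (*-comm Y X) XY≡pZ²) p∣Y
  ...   | a , c , Y≡pa² , X≡c² = inj₂ (a , c , X≡c² , Y≡pa²)

  even⊎odd : ∀ n → (∃ λ k → n ≡ 2 * k) ⊎ (∃ λ k → n ≡ 1 + 2 * k)
  even⊎odd zero = inj₁ (0 , refl)
  even⊎odd (suc n) with even⊎odd n
  ... | inj₁ (k , refl) = inj₂ (k , refl)
  ... | inj₂ (k , refl) = inj₁ (suc k , solve (k ∷ []))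

  0<m*n⇒0<n : ∀ m {n} → 0 < m * n → 0 < n
  0<m*n⇒0<n m {zero}  0<m*0 = contradiction (subst (0 <_) (*-zeroʳ m) 0<m*0) λ ()
  0<m*n⇒0<n m {suc n} _     = z<s

  0<m*n⇒0<m : ∀ m {n} → 0 < m * n → 0 < m
  0<m*n⇒0<m m {n} 0<mn = 0<m*n⇒0<n n (subst (0 <_) (*-comm m n) 0<mn)

  square-bound : ∀ {c n t} → c * c ≤ n → n < t * t → c < t
  square-bound {c} {t = t} c²≤n n<t² with t ≤? c
  ... | no  t≰c = ≰⇒> t≰c
  ... | yes t≤c = contradiction (≤-trans (*-mono-≤ t≤c t≤c) c²≤n) (<⇒≱ n<t²)

  odd-coprime-4 : ∀ j → Coprime (1 + 2 * j) 4
  odd-coprime-4 j (i∣odd , i∣4) with divisor-of-4 i∣4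
    where
    divisor-of-4 : ∀ {i} → i ∣ 4 → i ≡ 1 ⊎ 2 ∣ i
    divisor-of-4 {0} 0∣4 = contradiction (0∣⇒≡0 0∣4) λ ()
    divisor-of-4 {1} _ = inj₁ refl
    divisor-of-4 {2} _ = inj₂ ∣-refl
    divisor-of-4 {3} (divides (suc (suc _)) ())
    divisor-of-4 {4} _ = inj₂ (divides 2 refl)
    divisor-of-4 {suc (suc (suc (suc (suc _))))} i∣4 =
      contradiction (∣⇒≤ i∣4) λ { (s≤s (s≤s (s≤s (s≤s ())))) }
  ... | inj₁ i≡1 = i≡1
  ... | inj₂ 2∣i with ∣-trans 2∣i i∣odd
  ...   | divides k odd≡k*2 = contradiction (trans (*-comm 2 k) (sym odd≡k*2)) (even≢odd k j)

  mod-4 : ∀ r s A B → r + A * 4 ≡ s + B * 4 → r % 4 ≡ s % 4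
  mod-4 r s A B eq = begin
    r % 4           ≡⟨ [m+kn]%n≡m%n r A 4 ⟨
    (r + A * 4) % 4 ≡⟨ cong (_% 4) eq ⟩
    (s + B * 4) % 4 ≡⟨ [m+kn]%n≡m%n s B 4 ⟩
    s % 4           ∎
    where open ≡-Reasoning

  module _ {p : ℕ} (q : ℕ) where

    open ≡-Reasoning

    even²≢p*odd²+4 : p ≡ 1 + 4 * q → ∀ x y →
                     2 * x * (2 * x) ≢ p * ((1 + 2 * y) * (1 + 2 * y)) + 4
    even²≢p*odd²+4 refl x y eq =
      contradiction (mod-4 0 1 (x * x) (y + y * y + q * (1 + 2 * y) * (1 + 2 * y) + 1) (begin
        0 + x * x * 4                                          ≡⟨ solve (x ∷ []) ⟩
        2 * x * (2 * x)                                        ≡⟨ eq ⟩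
        (1 + 4 * q) * ((1 + 2 * y) * (1 + 2 * y)) + 4          ≡⟨ solve (q ∷ y ∷ []) ⟩
        1 + (y + y * y + q * (1 + 2 * y) * (1 + 2 * y) + 1) * 4 ∎)) λ ()

    even²≢p*square+1 : p ≡ 1 + 4 * q → ∀ x y → 2 * x * (2 * x) ≢ p * (y * y) + 1
    even²≢p*square+1 refl x y eq with even⊎odd y
    ... | inj₁ (w , refl) =
      contradiction (mod-4 0 1 (x * x) ((1 + 4 * q) * (w * w)) (begin
        0 + x * x * 4                          ≡⟨ solve (x ∷ []) ⟩
        2 * x * (2 * x)                        ≡⟨ eq ⟩
        (1 + 4 * q) * (2 * w * (2 * w)) + 1    ≡⟨ solve (q ∷ w ∷ []) ⟩
        1 + (1 + 4 * q) * (w * w) * 4          ∎)) λ ()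
    ... | inj₂ (w , refl) =
      contradiction (mod-4 0 2 (x * x) (w + w * w + q * (1 + 2 * w) * (1 + 2 * w)) (begin
        0 + x * x * 4                                        ≡⟨ solve (x ∷ []) ⟩
        2 * x * (2 * x)                                      ≡⟨ eq ⟩
        (1 + 4 * q) * ((1 + 2 * w) * (1 + 2 * w)) + 1        ≡⟨ solve (q ∷ w ∷ []) ⟩
        2 + (w + w * w + q * (1 + 2 * w) * (1 + 2 * w)) * 4  ∎)) λ ()

    odd²≢p*odd²+1 : p ≡ 1 + 4 * q → ∀ x y →
                    (1 + 2 * x) * (1 + 2 * x) ≢ p * ((1 + 2 * y) * (1 + 2 * y)) + 1
    odd²≢p*odd²+1 refl x y eq =
      contradiction (mod-4 1 2 (x + x * x) (y + y * y + q * (1 + 2 * y) * (1 + 2 * y)) (begin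
        1 + (x + x * x) * 4                                  ≡⟨ solve (x ∷ []) ⟩
        (1 + 2 * x) * (1 + 2 * x)                            ≡⟨ eq ⟩
        (1 + 4 * q) * ((1 + 2 * y) * (1 + 2 * y)) + 1        ≡⟨ solve (q ∷ y ∷ []) ⟩
        2 + (y + y * y + q * (1 + 2 * y) * (1 + 2 * y)) * 4  ∎)) λ ()

  data Pell± (p d x y : ℕ) : Set where
    plus  : x * x ≡ p * (y * y) + d → Pell± p d x y
    minus : x * x + d ≡ p * (y * y) → Pell± p d x y

  Pell±-scale : ∀ {p d x y} k → Pell± p d x y → Pell± p (k * k * d) (k * x) (k * y)
  Pell±-scale {p} {d} {x} {y} k (plus eq) = plus (begin
    k * x * (k * x)                   ≡⟨ solve (k ∷ x ∷ []) ⟩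
    k * k * (x * x)                   ≡⟨ cong (k * k *_) eq ⟩
    k * k * (p * (y * y) + d)         ≡⟨ solve (k ∷ p ∷ y ∷ d ∷ []) ⟩
    p * (k * y * (k * y)) + k * k * d ∎)
    where open ≡-Reasoning
  Pell±-scale {p} {d} {x} {y} k (minus eq) = minus (begin
    k * x * (k * x) + k * k * d       ≡⟨ solve (k ∷ x ∷ d ∷ []) ⟩
    k * k * (x * x + d)               ≡⟨ cong (k * k *_) eq ⟩
    k * k * (p * (y * y))             ≡⟨ solve (k ∷ p ∷ y ∷ []) ⟩
    p * (k * y * (k * y))             ∎)
    where open ≡-Reasoning

  halve-Pell+ : ∀ p x y → 2 * x * (2 * x) ≡ p * (2 * y * (2 * y)) + 4 → x * x ≡ p * (y * y) + 1
  halve-Pell+ p x y eq = *-cancelʳ-≡ _ _ 4 (begin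
    x * x * 4                    ≡⟨ solve (x ∷ []) ⟩
    2 * x * (2 * x)              ≡⟨ eq ⟩
    p * (2 * y * (2 * y)) + 4    ≡⟨ solve (p ∷ y ∷ []) ⟩
    (p * (y * y) + 1) * 4        ∎)
    where open ≡-Reasoning

  product-of-shifts⇒Pell± : ∀ {p X d Z} → Prime p → 1 ≤ X → Coprime X d →
    X * (X + d) ≡ p * (Z * Z) → ∃₂ λ c a → 1 ≤ c × 1 ≤ a × c * c ≤ X + d × Pell± p d c a
  product-of-shifts⇒Pell± {p} {X} {d} {Z} p-prime 1≤X X⊥d eq
    with coprime-product≡prime*square {Z = Z} p-prime X⊥X+d eq
    where
    X⊥X+d : Coprime X (X + d)
    X⊥X+d = Coprime.sym (Coprime.coprime-+ (Coprime.sym X⊥d))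
  ... | inj₁ (a , c , X≡pa² , X+d≡c²) =
    c , a , 0<m*n⇒0<n c (subst (0 <_) X+d≡c² (m≤n⇒m≤n+o d 1≤X)) ,
    0<m*n⇒0<n a (0<m*n⇒0<n p (subst (0 <_) X≡pa² 1≤X)) ,
    ≤-reflexive (sym X+d≡c²) , plus (trans (sym X+d≡c²) (cong (_+ d) X≡pa²))
  ... | inj₂ (a , c , X≡c² , X+d≡pa²) =
    c , a , 0<m*n⇒0<n c (subst (0 <_) X≡c² 1≤X) ,
    0<m*n⇒0<n a (0<m*n⇒0<n p (subst (0 <_) X+d≡pa² (m≤n⇒m≤n+o d 1≤X))) ,
    subst (_≤ X + d) X≡c² (m≤m+n X d) , minus (trans (cong (_+ d) (sym X≡c²)) X+d≡pa²)

  SmallerUnit : ℕ → ℕ → Set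
  SmallerUnit p t = ∃₂ λ x y → 1 ≤ x × 1 ≤ y × x < t × Pell± p 4 x y

  private
    smaller-unit-odd : ∀ {p j b} → Prime p → 1 ≤ b → (1 + 2 * j) * (1 + 2 * j + 4) ≡ p * (b * b) →
                       SmallerUnit p (1 + 2 * suc j)
    smaller-unit-odd {j = j} {b} p-prime 1≤b X[X+4]≡pb²
      with product-of-shifts⇒Pell± {Z = b} p-prime (s≤s z≤n) (odd-coprime-4 j) X[X+4]≡pb²
    ... | c , a , 1≤c , 1≤a , c²≤X+4 , pell =
      c , a , 1≤c , 1≤a , square-bound c²≤X+4 X+4<t² , pell
      where
      expand : 1 + 2 * j + 4 + suc (3 + 10 * j + 4 * (j * j)) ≡ (1 + 2 * suc j) * (1 + 2 * suc j)
      expand = solve (j ∷ [])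
      X+4<t² : 1 + 2 * j + 4 < (1 + 2 * suc j) * (1 + 2 * suc j)
      X+4<t² = <-≤-trans (m<m+n (1 + 2 * j + 4) z<s) (≤-reflexive expand)

    smaller-unit-even : ∀ {p r w} → Prime p → 1 ≤ w → r * (r + 1) ≡ p * (w * w) →
                        SmallerUnit p (2 * (1 + 2 * r))
    smaller-unit-even {p} {r} {w} p-prime 1≤w r[r+1]≡pw² =
      double (product-of-shifts⇒Pell± {Z = w} p-prime 1≤r (Coprime.sym (Coprime.1-coprimeTo r))
                                      r[r+1]≡pw²)
      where
      1≤r : 1 ≤ r
      1≤r = 0<m*n⇒0<m r (subst (1 ≤_) (sym r[r+1]≡pw²)
              (*-mono-≤ (>-nonZero⁻¹ p {{prime⇒nonZero p-prime}}) (*-mono-≤ 1≤w 1≤w)))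
      r+r≡2r : r + r ≡ 2 * r
      r+r≡2r = solve (r ∷ [])
      double : (∃₂ λ c a → 1 ≤ c × 1 ≤ a × c * c ≤ r + 1 × Pell± p 1 c a) →
               SmallerUnit p (2 * (1 + 2 * r))
      double (c , a , 1≤c , 1≤a , c²≤r+1 , pell) =
        2 * c , 2 * a , ≤-trans 1≤c (m≤m+n c _) , ≤-trans 1≤a (m≤m+n a _) , *-monoʳ-< 2 c<1+2r ,
        Pell±-scale 2 pell
        where
        c<1+2r : c < 1 + 2 * r
        c<1+2r = s≤s (≤-trans (m≤m*n c c {{>-nonZero 1≤c}})
                   (≤-trans c²≤r+1 (≤-trans (+-monoʳ-≤ r 1≤r) (≤-reflexive r+r≡2r))))

  -- t² − 4 = p b² is (t − 2)(t + 2) = p b² for odd t; for even t it forces t = 2(1 + 2r),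
  -- b = 4w and r (r + 1) = p w², the other parities being impossible modulo 4.
  norm-plus⇒smaller-unit : ∀ {p t b} q → Prime p → p ≡ 1 + 4 * q → 1 ≤ b →
                           t * t ≡ p * (b * b) + 4 → SmallerUnit p t
  norm-plus⇒smaller-unit {p} {t} {b} q p-prime p≡1+4q 1≤b eq with even⊎odd t
  ... | inj₂ (zero , refl) = contradiction (trans eq (+-comm _ 4)) λ ()
  ... | inj₂ (suc j , refl) = smaller-unit-odd {j = j} p-prime 1≤b (+-cancelʳ-≡ 4 _ _ (begin
    (1 + 2 * j) * (1 + 2 * j + 4) + 4 ≡⟨ solve (j ∷ []) ⟩
    (1 + 2 * suc j) * (1 + 2 * suc j) ≡⟨ eq ⟩
    p * (b * b) + 4                   ∎))
    where open ≡-Reasoning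
  ... | inj₁ (x , refl) with even⊎odd b
  ...   | inj₂ (y , refl) = contradiction eq (even²≢p*odd²+4 q p≡1+4q x y)
  ...   | inj₁ (y , refl) with even⊎odd x | even⊎odd y
  ...     | inj₁ (v , refl) | _ =
    contradiction (halve-Pell+ p (2 * v) y eq) (even²≢p*square+1 q p≡1+4q v y)
  ...     | inj₂ (r , refl) | inj₂ (w , refl) =
    contradiction (halve-Pell+ p (1 + 2 * r) (1 + 2 * w) eq) (odd²≢p*odd²+1 q p≡1+4q r w)
  ...     | inj₂ (r , refl) | inj₁ (w , refl) =
    smaller-unit-even {p} {r} {w} p-prime (0<m*n⇒0<n 2 (0<m*n⇒0<n 2 1≤b))
      (*-cancelʳ-≡ _ _ 4 (suc-injective (begin
        1 + r * (r + 1) * 4           ≡⟨ solve (r ∷ []) ⟩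
        (1 + 2 * r) * (1 + 2 * r)     ≡⟨ halve-Pell+ p (1 + 2 * r) (2 * w) eq ⟩
        p * (2 * w * (2 * w)) + 1     ≡⟨ solve (p ∷ w ∷ []) ⟩
        1 + p * (w * w) * 4           ∎)))
    where open ≡-Reasoning

  pos-norm : ∀ p x y → + x ℤ.* + x ℤ.- + p ℤ.* (+ y ℤ.* + y) ≡ + (x * x) ℤ.- + (p * (y * y))
  pos-norm p x y = cong₂ ℤ._-_ (sym (ℤ.pos-* x x))
    (trans (cong (+ p ℤ.*_) (sym (ℤ.pos-* y y))) (sym (ℤ.pos-* p (y * y))))

  private
    a+b-a≡b : ∀ a b → a ℤ.+ b ℤ.- a ≡ b
    a+b-a≡b = ℤ-Solver.solve-∀
    a-[a+b]≡-b : ∀ a b → a ℤ.- (a ℤ.+ b) ≡ ℤ.- b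
    a-[a+b]≡-b = ℤ-Solver.solve-∀
    a≡a-b+b : ∀ a b → a ≡ a ℤ.- b ℤ.+ b
    a≡a-b+b = ℤ-Solver.solve-∀

  Pell±⇒IsUnitCoords : ∀ {p x y} → Pell± p 4 x y → IsUnitCoords p (+ x) (+ y)
  Pell±⇒IsUnitCoords {p} {x} {y} (plus eq) = inj₁ (begin
    + x ℤ.* + x ℤ.- + p ℤ.* (+ y ℤ.* + y)        ≡⟨ pos-norm p x y ⟩
    + (x * x) ℤ.- + (p * (y * y))                ≡⟨ cong (λ n → + n ℤ.- + (p * (y * y))) eq ⟩
    + (p * (y * y) + 4) ℤ.- + (p * (y * y))
      ≡⟨ cong (ℤ._- + (p * (y * y))) (ℤ.pos-+ (p * (y * y)) 4) ⟩
    + (p * (y * y)) ℤ.+ + 4 ℤ.- + (p * (y * y))  ≡⟨ a+b-a≡b (+ (p * (y * y))) (+ 4) ⟩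
    + 4                                          ∎)
    where open ≡-Reasoning
  Pell±⇒IsUnitCoords {p} {x} {y} (minus eq) = inj₂ (begin
    + x ℤ.* + x ℤ.- + p ℤ.* (+ y ℤ.* + y)        ≡⟨ pos-norm p x y ⟩
    + (x * x) ℤ.- + (p * (y * y))                ≡⟨ cong (λ n → + (x * x) ℤ.- + n) eq ⟨
    + (x * x) ℤ.- + (x * x + 4)                  ≡⟨ cong (λ z → + (x * x) ℤ.- z) (ℤ.pos-+ (x * x) 4) ⟩
    + (x * x) ℤ.- (+ (x * x) ℤ.+ + 4)            ≡⟨ a-[a+b]≡-b (+ (x * x)) (+ 4) ⟩
    ℤ.- + 4                                      ∎)
    where open ≡-Reasoning

  norm+4⇒Pell+ : ∀ {p x y} → + x ℤ.* + x ℤ.- + p ℤ.* (+ y ℤ.* + y) ≡ + 4 → x * x ≡ p * (y * y) + 4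
  norm+4⇒Pell+ {p} {x} {y} eq = ℤ.+-injective (begin
    + (x * x)                                         ≡⟨ a≡a-b+b (+ (x * x)) (+ (p * (y * y))) ⟩
    + (x * x) ℤ.- + (p * (y * y)) ℤ.+ + (p * (y * y))
      ≡⟨ cong (ℤ._+ + (p * (y * y))) (trans (sym (pos-norm p x y)) eq) ⟩
    + 4 ℤ.+ + (p * (y * y))                           ≡⟨ ℤ.+-comm (+ 4) (+ (p * (y * y))) ⟩
    + (p * (y * y)) ℤ.+ + 4                           ≡⟨ ℤ.pos-+ (p * (y * y)) 4 ⟨
    + (p * (y * y) + 4)                               ∎)
    where open ≡-Reasoning

  fundamental-unit-norm≡-1 : ∀ {p t b} → Prime p → p % 4 ≡ 1 → IsFundamentalUnit p t b →
                             + t ℤ.* + t ℤ.- + p ℤ.* (+ b ℤ.* + b) ≡ ℤ.- + 4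
  fundamental-unit-norm≡-1 p-prime p%4≡1 (_ , _ , inj₂ norm≡-4 , _) = norm≡-4
  fundamental-unit-norm≡-1 {p} {t} {b} p-prime p%4≡1 (_ , 1≤b , inj₁ norm≡4 , minimal)
    with norm-plus⇒smaller-unit (p / 4) p-prime p≡1+4q 1≤b (norm+4⇒Pell+ {p} {t} {b} norm≡4)
    where
    p≡1+4q : p ≡ 1 + 4 * (p / 4)
    p≡1+4q = trans (m≡m%n+[m/n]*n p 4) (cong₂ _+_ p%4≡1 (*-comm (p / 4) 4))
  ... | x , y , 1≤x , 1≤y , x<t , pell =
    contradiction (proj₁ (minimal x y 1≤x 1≤y (Pell±⇒IsUnitCoords pell))) (<⇒≱ x<t)

  fundamental-unit-t²+4≡b²p : ∀ {p t b} → Prime p → p % 4 ≡ 1 → IsFundamentalUnit p t b →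
                              + t ℤ.* + t ℤ.+ + 4 ≡ + b ℤ.* + b ℤ.* + p
  fundamental-unit-t²+4≡b²p {p} {t} {b} p-prime p%4≡1 fu =
    a-pb²≡-4⇒a+4≡b²p (+ t ℤ.* + t) (+ p) (+ b) (fundamental-unit-norm≡-1 p-prime p%4≡1 fu)
    where
    a-pb²≡-4⇒a+4≡b²p : ∀ a p b → a ℤ.- p ℤ.* (b ℤ.* b) ≡ ℤ.- + 4 → a ℤ.+ + 4 ≡ b ℤ.* b ℤ.* p
    a-pb²≡-4⇒a+4≡b²p a p b eq =
      trans (shuffle a p b)
            (trans (cong (λ z → z ℤ.+ + 4 ℤ.+ b ℤ.* b ℤ.* p) eq) (ℤ.+-identityˡ (b ℤ.* b ℤ.* p)))
      where
      shuffle : ∀ a p b → a ℤ.+ + 4 ≡ a ℤ.- p ℤ.* (b ℤ.* b) ℤ.+ + 4 ℤ.+ b ℤ.* b ℤ.* p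
      shuffle = ℤ-Solver.solve-∀

module RationalIdentities where

  open import Data.Rational as ℚ using (ℚ; _+_; _-_; _*_; -_; ½; 0ℚ)
  import Data.Rational.Properties as ℚ
  import Data.Rational.Unnormalised as ℚᵘ
  import Data.Rational.Unnormalised.Properties as ℚᵘ
  import Data.Integer.Tactic.RingSolver as ℤ-Solver
  open import Data.List.Base using (_∷_; [])
  open import Data.Product using (_,_)
  open import Relation.Nullary.Decidable.Core using (dec⇒maybe)
  open import Tactic.RingSolver using (solve)
  import Tactic.RingSolver.Core.AlmostCommutativeRing as ACR
  open import Relation.Binary.PropositionalEquality

  toℚᵘ-toℚ : ∀ z → ℚ.toℚᵘ (toℚ z) ℚᵘ.≃ ℚᵘ.mkℚᵘ z 0
  toℚᵘ-toℚ z = ℚ.toℚᵘ-fromℚᵘ (ℚᵘ.mkℚᵘ z 0)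

  toℚ-homo-* : ∀ x y → toℚ (x ℤ.* y) ≡ toℚ x * toℚ y
  toℚ-homo-* x y = ℚ.toℚᵘ-injective (ℚᵘ.≃-trans (toℚᵘ-toℚ (x ℤ.* y)) (ℚᵘ.≃-sym
    (ℚᵘ.≃-trans (ℚ.toℚᵘ-homo-* (toℚ x) (toℚ y)) (ℚᵘ.*-cong (toℚᵘ-toℚ x) (toℚᵘ-toℚ y)))))

  toℚ-homo-+ : ∀ x y → toℚ (x ℤ.+ y) ≡ toℚ x + toℚ y
  toℚ-homo-+ x y = ℚ.toℚᵘ-injective (ℚᵘ.≃-trans (toℚᵘ-toℚ (x ℤ.+ y)) (ℚᵘ.≃-sym
    (ℚᵘ.≃-trans (ℚ.toℚᵘ-homo-+ (toℚ x) (toℚ y))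
      (ℚᵘ.≃-trans (ℚᵘ.+-cong (toℚᵘ-toℚ x) (toℚᵘ-toℚ y)) (ℚᵘ.*≡* (denominators-one x y))))))
    where
    denominators-one : ∀ x y → (x ℤ.* ℤ.+ 1 ℤ.+ y ℤ.* ℤ.+ 1) ℤ.* ℤ.+ 1 ≡ (x ℤ.+ y) ℤ.* ℤ.+ 1
    denominators-one = ℤ-Solver.solve-∀

  toℚ-homo‿- : ∀ x → toℚ (ℤ.- x) ≡ - toℚ x
  toℚ-homo‿- x = ℚ.toℚᵘ-injective (ℚᵘ.≃-trans (toℚᵘ-toℚ (ℤ.- x)) (ℚᵘ.≃-sym
    (ℚᵘ.≃-trans (ℚ.toℚᵘ-homo‿- (toℚ x)) (ℚᵘ.-‿cong (toℚᵘ-toℚ x)))))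

  toℚ-homo-− : ∀ x y → toℚ (x ℤ.- y) ≡ toℚ x - toℚ y
  toℚ-homo-− x y = trans (toℚ-homo-+ x (ℤ.- y)) (cong (λ z → toℚ x + z) (toℚ-homo‿- y))

  2ℚ 4ℚ : ℚ
  2ℚ = toℚ (ℤ.+ 2)
  4ℚ = toℚ (ℤ.+ 4)

  toℚ-Pell : ∀ ℓ f Δ → ℓ ℤ.* ℓ ℤ.+ ℤ.+ 4 ≡ Δ ℤ.* (f ℤ.* f) →
             toℚ ℓ * toℚ ℓ + 4ℚ ≡ toℚ Δ * (toℚ f * toℚ f)
  toℚ-Pell ℓ f Δ eq = begin
    toℚ ℓ * toℚ ℓ + 4ℚ             ≡⟨ cong (_+ 4ℚ) (toℚ-homo-* ℓ ℓ) ⟨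
    toℚ (ℓ ℤ.* ℓ) + 4ℚ             ≡⟨ toℚ-homo-+ (ℓ ℤ.* ℓ) (ℤ.+ 4) ⟨
    toℚ (ℓ ℤ.* ℓ ℤ.+ ℤ.+ 4)        ≡⟨ cong toℚ eq ⟩
    toℚ (Δ ℤ.* (f ℤ.* f))          ≡⟨ toℚ-homo-* Δ (f ℤ.* f) ⟩
    toℚ Δ * toℚ (f ℤ.* f)          ≡⟨ cong (toℚ Δ *_) (toℚ-homo-* f f) ⟩
    toℚ Δ * (toℚ f * toℚ f)        ∎
    where open ≡-Reasoning

  ℚ-ring : ACR.AlmostCommutativeRing _ _
  ℚ-ring = ACR.fromCommutativeRing ℚ.+-*-commutativeRing λ x → dec⇒maybe (0ℚ ℚ.≟ x)

  module _ (ℓ f M g Δ : ℚ) (hℓ : ℓ * ℓ + 4ℚ ≡ Δ * (f * f)) (hM : M * M + 4ℚ ≡ Δ * (g * g)) where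

    open ≡-Reasoning

    norm+4≡ : M * ℓ * ½ * (M * ℓ * ½) - Δ * ((ℓ * g - 2ℚ * f) * (ℓ * g - 2ℚ * f)) * ½ * ½ + 4ℚ
              ≡ ℓ * (Δ * f * g - 2ℚ * ℓ)
    norm+4≡ = begin
      M * ℓ * ½ * (M * ℓ * ½) - Δ * ((ℓ * g - 2ℚ * f) * (ℓ * g - 2ℚ * f)) * ½ * ½ + 4ℚ
        ≡⟨ solve (ℓ ∷ f ∷ M ∷ g ∷ Δ ∷ []) ℚ-ring ⟩
      (ℓ * ℓ * (M * M - Δ * (g * g)) + 4ℚ * ℓ * (Δ * f * g) - 4ℚ * (Δ * (f * f))) * ½ * ½ + 4ℚ
        ≡⟨ cong₂ (λ u v → (ℓ * ℓ * (M * M - u) + 4ℚ * ℓ * (Δ * f * g) - 4ℚ * v) * ½ * ½ + 4ℚ)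
                 (sym hM) (sym hℓ) ⟩
      (ℓ * ℓ * (M * M - (M * M + 4ℚ)) + 4ℚ * ℓ * (Δ * f * g) - 4ℚ * (ℓ * ℓ + 4ℚ)) * ½ * ½ + 4ℚ
        ≡⟨ solve (ℓ ∷ f ∷ M ∷ g ∷ Δ ∷ []) ℚ-ring ⟩
      ℓ * (Δ * f * g - 2ℚ * ℓ) ∎

    [Δfg-2ℓ]²-4M²≡ΔB² : (Δ * f * g - 2ℚ * ℓ) * (Δ * f * g - 2ℚ * ℓ) - 4ℚ * (M * M)
                        ≡ Δ * ((ℓ * g - 2ℚ * f) * (ℓ * g - 2ℚ * f))
    [Δfg-2ℓ]²-4M²≡ΔB² = begin
      (Δ * f * g - 2ℚ * ℓ) * (Δ * f * g - 2ℚ * ℓ) - 4ℚ * (M * M)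
        ≡⟨ solve (ℓ ∷ f ∷ M ∷ g ∷ Δ ∷ []) ℚ-ring ⟩
      Δ * (f * f) * (Δ * (g * g)) - 4ℚ * ℓ * (Δ * f * g) + 4ℚ * (ℓ * ℓ) - 4ℚ * (M * M)
        ≡⟨ cong₂ (λ u v → u * v - 4ℚ * ℓ * (Δ * f * g) + 4ℚ * (ℓ * ℓ) - 4ℚ * (M * M))
                 (sym hℓ) (sym hM) ⟩
      (ℓ * ℓ + 4ℚ) * (M * M + 4ℚ) - 4ℚ * ℓ * (Δ * f * g) + 4ℚ * (ℓ * ℓ) - 4ℚ * (M * M)
        ≡⟨ solve (ℓ ∷ f ∷ M ∷ g ∷ Δ ∷ []) ℚ-ring ⟩
      ℓ * ℓ * (M * M + 4ℚ) - 4ℚ * ℓ * (Δ * f * g) + 4ℚ * (ℓ * ℓ + 4ℚ)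
        ≡⟨ cong₂ (λ u v → ℓ * ℓ * u - 4ℚ * ℓ * (Δ * f * g) + 4ℚ * v) hM hℓ ⟩
      ℓ * ℓ * (Δ * (g * g)) - 4ℚ * ℓ * (Δ * f * g) + 4ℚ * (Δ * (f * f))
        ≡⟨ solve (ℓ ∷ f ∷ M ∷ g ∷ Δ ∷ []) ℚ-ring ⟩
      Δ * ((ℓ * g - 2ℚ * f) * (ℓ * g - 2ℚ * f)) ∎

  norm-trace-identity : ∀ ℓ f M g β π x y B → x ≡ M * ℓ → B ≡ ℓ * g - 2ℚ * f → y ≡ B * β →
    ℓ * ℓ + 4ℚ ≡ β * β * π * (f * f) → M * M + 4ℚ ≡ β * β * π * (g * g) →
    let N = x * ½ * (x * ½) - π * (y * ½ * (y * ½))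
        T = x * ½ + x * ½
        E = (N + 4ℚ) * (N + 4ℚ) - 4ℚ * (T * T)
    in (E ≡ ℓ * ℓ * (β * β) * π * (B * B)) × ∃ λ q → E ≡ π * (q * q)
  norm-trace-identity ℓ f M g β π _ _ _ refl refl refl hℓ hM =
    E≡ℓ²β²πB² , ℓ * β * B , E≡π[ℓβB]²
    where
    open ≡-Reasoning
    B N T K : ℚ
    B = ℓ * g - 2ℚ * f
    N = M * ℓ * ½ * (M * ℓ * ½) - π * (B * β * ½ * (B * β * ½))
    T = M * ℓ * ½ + M * ℓ * ½
    K = β * β * π * f * g - 2ℚ * ℓ
    N≡ : ∀ M ℓ β π B → M * ℓ * ½ * (M * ℓ * ½) - π * (B * β * ½ * (B * β * ½))
                       ≡ M * ℓ * ½ * (M * ℓ * ½) - β * β * π * (B * B) * ½ * ½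
    N≡ M ℓ β π B = solve (M ∷ ℓ ∷ β ∷ π ∷ B ∷ []) ℚ-ring
    factor-ℓ² : ∀ ℓ K M →
      ℓ * K * (ℓ * K) - 4ℚ * ((M * ℓ * ½ + M * ℓ * ½) * (M * ℓ * ½ + M * ℓ * ½))
      ≡ ℓ * ℓ * (K * K - 4ℚ * (M * M))
    factor-ℓ² ℓ K M = solve (ℓ ∷ K ∷ M ∷ []) ℚ-ring
    reassociate : ∀ ℓ β π B → ℓ * ℓ * (β * β * π * (B * B)) ≡ ℓ * ℓ * (β * β) * π * (B * B)
    reassociate ℓ β π B = solve (ℓ ∷ β ∷ π ∷ B ∷ []) ℚ-ring
    as-p*square : ∀ ℓ β π B → ℓ * ℓ * (β * β) * π * (B * B) ≡ π * (ℓ * β * B * (ℓ * β * B))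
    as-p*square ℓ β π B = solve (ℓ ∷ β ∷ π ∷ B ∷ []) ℚ-ring
    N+4≡ℓK : N + 4ℚ ≡ ℓ * K
    N+4≡ℓK = trans (cong (_+ 4ℚ) (N≡ M ℓ β π B)) (norm+4≡ ℓ f M g (β * β * π) hℓ hM)
    E≡ℓ²β²πB² : (N + 4ℚ) * (N + 4ℚ) - 4ℚ * (T * T) ≡ ℓ * ℓ * (β * β) * π * (B * B)
    E≡ℓ²β²πB² = begin
      (N + 4ℚ) * (N + 4ℚ) - 4ℚ * (T * T)  ≡⟨ cong (λ z → z * z - 4ℚ * (T * T)) N+4≡ℓK ⟩
      ℓ * K * (ℓ * K) - 4ℚ * (T * T)      ≡⟨ factor-ℓ² ℓ K M ⟩
      ℓ * ℓ * (K * K - 4ℚ * (M * M))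
        ≡⟨ cong (ℓ * ℓ *_) ([Δfg-2ℓ]²-4M²≡ΔB² ℓ f M g (β * β * π) hℓ hM) ⟩
      ℓ * ℓ * (β * β * π * (B * B))       ≡⟨ reassociate ℓ β π B ⟩
      ℓ * ℓ * (β * β) * π * (B * B)       ∎
    E≡π[ℓβB]² : (N + 4ℚ) * (N + 4ℚ) - 4ℚ * (T * T) ≡ π * (ℓ * β * B * (ℓ * β * B))
    E≡π[ℓβB]² = trans E≡ℓ²β²πB² (as-p*square ℓ β π B)

open import Data.Rational using (ℚ; _+_; _-_; _*_)

lemma11 : (p t b : ℕ) → Prime p → p % 8 ≡ 5 → IsFundamentalUnit p t b →
    (m n : ℤ) → OddInt m → OddInt n →
    let N = norm p (α t b m n)
        T = trace p (α t b m n)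
        E = (N + toℚ (+ 4)) * (N + toℚ (+ 4)) - toℚ (+ 4) * (T * T)
        Lm = toℚ (𝓛 t m)
        B = toℚ (𝓛 t m Data.Integer.* 𝓕 t n Data.Integer.- + 2 Data.Integer.* 𝓕 t m)
    in (E ≡ Lm * Lm * (toℚ (+ b) * toℚ (+ b)) * toℚ (+ p) * (B * B))
       × ∃ λ (q : ℚ) → E ≡ toℚ (+ p) * (q * q)
lemma11 p t b p-prime p%8≡5 fu m n odd-m odd-n =
  norm-trace-identity ℓ f M g β π _ _ B (toℚ-homo-* (𝓛 t n) (𝓛 t m)) B≡ℓg-2f
    (toℚ-homo-* (𝓛 t m ℤ.* 𝓕 t n ℤ.- + 2 ℤ.* 𝓕 t m) (+ b)) (pell m odd-m) (pell n odd-n)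
  where
  open LucasSequences using (𝓛²+4≡[t²+4]𝓕²)
  open NormOfFundamentalUnit using (fundamental-unit-t²+4≡b²p)
  open RationalIdentities
  ℓ f M g β π B : ℚ
  ℓ = toℚ (𝓛 t m)
  f = toℚ (𝓕 t m)
  M = toℚ (𝓛 t n)
  g = toℚ (𝓕 t n)
  β = toℚ (+ b)
  π = toℚ (+ p)
  B = toℚ (𝓛 t m ℤ.* 𝓕 t n ℤ.- + 2 ℤ.* 𝓕 t m)
  p%4≡1 : p % 4 ≡ 1
  p%4≡1 = trans (sym (m∣n⇒o%n%m≡o%m 4 8 p (divides 2 refl))) (cong (_% 4) p%8≡5)
  t²+4≡b²p : + t ℤ.* + t ℤ.+ + 4 ≡ + b ℤ.* + b ℤ.* + p
  t²+4≡b²p = fundamental-unit-t²+4≡b²p p-prime p%4≡1 fu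
  Δ≡β²π : toℚ (+ b ℤ.* + b ℤ.* + p) ≡ β * β * π
  Δ≡β²π = trans (toℚ-homo-* (+ b ℤ.* + b) (+ p)) (cong (_* π) (toℚ-homo-* (+ b) (+ b)))
  pell : ∀ k → OddInt k →
         toℚ (𝓛 t k) * toℚ (𝓛 t k) + 4ℚ ≡ β * β * π * (toℚ (𝓕 t k) * toℚ (𝓕 t k))
  pell k odd-k = trans (toℚ-Pell (𝓛 t k) (𝓕 t k) (+ b ℤ.* + b ℤ.* + p)
      (trans (𝓛²+4≡[t²+4]𝓕² t k odd-k) (cong (ℤ._* (𝓕 t k ℤ.* 𝓕 t k)) t²+4≡b²p)))
    (cong (_* (toℚ (𝓕 t k) * toℚ (𝓕 t k))) Δ≡β²π)
  B≡ℓg-2f : B ≡ ℓ * g - 2ℚ * f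
  B≡ℓg-2f = trans (toℚ-homo-− (𝓛 t m ℤ.* 𝓕 t n) (+ 2 ℤ.* 𝓕 t m))
                  (cong₂ _-_ (toℚ-homo-* (𝓛 t m) (𝓕 t n)) (toℚ-homo-* (+ 2) (𝓕 t m)))
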